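{- Let $G=(V,E)$ be a finite simple graph and suppose $\bar{x}=(x_0,\dots,x_k)\in ET_{k,k}(G)\subseteq EMC_{k,k}(G)$ satisfies $\partial_{k,k}\bar{x}=0$. Consider the complete class graph \[\mathcal{H}(\{\bar{x}\})=\Big(L(\bar{x}),\ E_S=\{\{x_i,x_{i+1}\}\}_{i\in[k-1]_0}\cup\{\{x_{i-1},x_{i+1}\}\}_{i\in[k-1]},\ E_B=\tbinom{L(\bar{x})}{2}\setminus E_S\Big).\] Then $G\vert_{L(\bar{x})}\in\Gamma(\mathcal{H}(\{\bar{x}\}))$.
   Context: $[m]=\{1,\dots,m\}$, $[m]_0=\{0,\dots,m\}$. With path metric $d$ on $G$, a $k$-trail is $(x_0,\dots,x_k)\in V^{k+1}$ with $x_i\neq x_{i+1}$, $d(x_i,x_{i+1})<\infty$; its length is $\sum_i d(x_i,x_{i+1})$; it is eulerian if all entries are distinct; $L(\bar{x})=\{x_0,\dots,x_k\}$ is its set of landmarks. $ET_{k,\ell}(G)$ is the set of eulerian $k$-trails of length $\ell$; $EMC_{k,\ell}(G)$ is the free abelian group on it, with differential $\partial_{k,\ell}=\sum_{i=1}^{k-1}(-1)^i\partial^i_{k,\ell}$, where $\partial^i_{k,\ell}(x_0,\dots,x_k)=(x_0,\dots,\widehat{x_i},\dots,x_k)$ if this tuple has length $\ell$ and $0$ otherwise. $G\vert_W$ is the full (induced) subgraph on $W$. A class graph $\mathcal{G}=(W,E_S,E_B)$ consists of a vertex set $W$ and two disjoint sets $E_S,E_B\subseteq\binom W2$; it is complete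 if $E_S\cup E_B=\binom W2$. $\Gamma(\mathcal{G})$ is the set of graphs $(W,E')$ with $E_S\subseteq E'\subseteq E_S\cup E_B$. -}

module Defs where

open import Data.Nat using (ℕ; zero; suc; _+_; _<_; _≤_)
open import Data.Bool using (Bool; true; false; _∧_; _∨_; if_then_else_)
open import Data.Fin using (Fin; toℕ; inject₁) renaming (_≟_ to _≟F_)
open import Data.Fin.Properties using ()
open import Data.List using (List; []; _∷_; allFin; foldr; filterᵇ)
open import Data.Bool.ListAction using (any)
open import Data.Maybe using (Maybe; just; nothing; _>>=_)
import Data.Maybe as M
open import Data.Vec using (Vec; lookup; toList; removeAt)
open import Data.Vec.Properties using (≡-dec)
open import Data.Vec.Membership.Propositional using (_∈_)
open import Data.Integer using (ℤ; 0ℤ; 1ℤ; -1ℤ) renaming (_+_ to _+ℤ_; _*_ to _*ℤ_)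
open import Data.Product using (Σ; _×_)
open import Data.Sum using (_⊎_)
open import Relation.Nullary using (¬_; does)
open import Relation.Nullary.Decidable using (⌊_⌋)
open import Relation.Binary.PropositionalEquality using (_≡_; _≢_)

record SimpleGraph (n : ℕ) : Set where
  field
    adj    : Fin n → Fin n → Bool
    sym    : ∀ x y → adj x y ≡ adj y x
    irrefl : ∀ x → adj x x ≡ false
open SimpleGraph public

module _ {n : ℕ} (G : SimpleGraph n) where

  reach : ℕ → Fin n → Fin n → Bool
  reach zero    x y = ⌊ x ≟F y ⌋
  reach (suc m) x y = reach m x y ∨ any (λ z → reach m x z ∧ adj G z y) (allFin n)

  search : (ℕ → Bool) → ℕ → Maybe ℕ
  search f zero    = nothing
  search f (suc b) with search f b
  ... | just m  = just m
  ... | nothing = if f b then just b else nothing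

  -- path metric; nothing represents ∞ (any shortest walk has < n+1 edges)
  dist : Fin n → Fin n → Maybe ℕ
  dist x y = search (λ m → reach m x y) (suc n)

  tupleLength : List (Fin n) → Maybe ℕ
  tupleLength []           = just 0
  tupleLength (x ∷ [])     = just 0
  tupleLength (x ∷ y ∷ r)  = dist x y >>= λ d → M.map (d +_) (tupleLength (y ∷ r))

  IsTrail : {k : ℕ} → Vec (Fin n) (suc k) → Set
  IsTrail {k} xs = (i : Fin k) →
    (lookup xs (inject₁ i) ≢ lookup xs (Fin.suc i)) ×
    Σ ℕ (λ d → dist (lookup xs (inject₁ i)) (lookup xs (Fin.suc i)) ≡ just d)

  IsEulerian : {k : ℕ} → Vec (Fin n) (suc k) → Set
  IsEulerian {k} xs = ∀ (i j : Fin (suc k)) → lookup xs i ≡ lookup xs j → i ≡ j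

  InET : (k ℓ : ℕ) → Vec (Fin n) (suc k) → Set
  InET k ℓ xs = IsTrail xs × IsEulerian xs × (tupleLength (toList xs) ≡ just ℓ)

  sign : ℕ → ℤ
  sign zero    = 1ℤ
  sign (suc i) = -1ℤ *ℤ sign i

  -- ∂_{k,ℓ} applied to the generator xs, as an element of EMC_{k-1,ℓ}(G),
  -- represented by its coefficient function on (k-1)-tuples:
  -- coefficient of y is  Σ_{i=1}^{k-1} (-1)^i [∂^i xs = y, of length ℓ].
  ∂ : (k ℓ : ℕ) → Vec (Fin n) (suc k) → (Vec (Fin n) k → ℤ)
  ∂ k ℓ xs y = foldr _+ℤ_ 0ℤ (Data.List.map term inner)
    where
      inner : List (Fin (suc k))
      inner = filterᵇ (λ i → ⌊ Data.Nat._<?_ 0 (toℕ i) ⌋ ∧ ⌊ Data.Nat._<?_ (toℕ i) k ⌋) (allFin (suc k))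
      face : Fin (suc k) → Vec (Fin n) k
      face i = removeAt xs i
      hasLen : Vec (Fin n) k → Bool
      hasLen v with tupleLength (toList v)
      ... | just m  = ⌊ Data.Nat._≟_ m ℓ ⌋
      ... | nothing = false
      term : Fin (suc k) → ℤ
      term i = if ⌊ ≡-dec _≟F_ (face i) y ⌋ ∧ hasLen (face i) then sign (toℕ i) else 0ℤ

  inducedEdge : (Fin n → Set) → Fin n → Fin n → Set
  inducedEdge W x y = W x × W y × (adj G x y ≡ true)

-- Class graphs  (W, E_S, E_B), pairs represented as symmetric relations

record ClassGraph (n : ℕ) : Set₁ where
  field
    W  : Fin n → Set
    ES : Fin n → Fin n → Set
    EB : Fin n → Fin n → Set
open ClassGraph public

InΓ : {n : ℕ} → ClassGraph n → (Fin n → Set) → (Fin n → Fin n → Set) → Set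
InΓ 𝒢 V E' = (∀ v → (V v → W 𝒢 v) × (W 𝒢 v → V v))
           × (∀ x y → ES 𝒢 x y → E' x y)
           × (∀ x y → E' x y → ES 𝒢 x y ⊎ EB 𝒢 x y)

UPair : {A : Set} → A → A → A → A → Set
UPair a b x y = (x ≡ a × y ≡ b) ⊎ (x ≡ b × y ≡ a)

L : {n k : ℕ} → Vec (Fin n) (suc k) → Fin n → Set
L xs v = v ∈ xs

H : {n k : ℕ} → Vec (Fin n) (suc k) → ClassGraph n
H {n} {k} xs = record { W = L xs ; ES = S ; EB = B }
  where
    S : Fin n → Fin n → Set
    S x y =
      Σ (Fin (suc k)) (λ i → Σ (Fin (suc k)) λ j →
          (toℕ j ≡ toℕ i + 1) × UPair (lookup xs i) (lookup xs j) x y)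
      ⊎ Σ (Fin (suc k)) (λ i → Σ (Fin (suc k)) λ j →
          (toℕ j ≡ toℕ i + 2) × UPair (lookup xs i) (lookup xs j) x y)
    B : Fin n → Fin n → Set
    B x y = L xs x × L xs y × (x ≢ y) × ¬ S x y

-- Consecutive entries of a trail are distinct, so each of its k steps has length ≥ 1; a
-- k-trail of length k therefore has all steps of length 1, and consecutive landmarks are
-- adjacent. For x_i, x_{i+2} the path x_i x_{i+1} x_{i+2} gives d(x_i, x_{i+2}) ≤ 2, and the
-- endpoints are distinct. If the distance were 2, the face ∂^{i+1} x̄ would again have
-- length k; the faces of an eulerian trail are pairwise distinct, so this face occurs in
-- ∂x̄ with coefficient ±1, contradicting ∂x̄ = 0. Hence the distance is 1. Every other edge
-- of G|_{L(x̄)} joins two distinct landmarks outside E_S, i.e. lies in E_B.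
module Submission where

open import Defs renaming (sym to adj-sym)
open import Data.Nat using (ℕ; zero; suc; _+_; _≤_; _<_; z≤n; s≤s; _<?_; pred) renaming (_≟_ to _≟ℕ_)
open import Data.Nat.Properties using (suc-injective; +-mono-≤; ≤-antisym; ≤-refl; m≤n+m; +-cancelʳ-≡; <⇒≤; m≤n⇒m≤1+n; m≤n⇒m<n∨m≡n)
open import Data.Bool using (Bool; true; false; T; _∧_; if_then_else_)
open import Data.Bool.Properties using (T-≡; T-∧; T-∨)
open import Data.Fin using (Fin; zero; suc; toℕ; inject₁) renaming (_≟_ to _≟F_)
open import Data.Fin.Properties using (any?; inject₁ℕ<) renaming (suc-injective to Fin-suc-injective)
open import Data.Vec using (Vec; []; _∷_; lookup; toList; removeAt)
open import Data.Vec.Properties using (≡-dec; ∷-injectiveˡ; ∷-injectiveʳ)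
open import Data.Vec.Membership.Propositional.Properties using (∈-lookup)
open import Data.List using (List; _∷_; foldr; map; allFin; filterᵇ)
open import Data.List.Membership.Propositional using (_∈_; lose)
open import Data.List.Membership.Propositional.Properties using (∈-allFin; ∈-filter⁺)
open import Data.List.Relation.Unary.All as All using (All; []; _∷_)
open import Data.List.Relation.Unary.Any using (here; there; satisfied)
open import Data.List.Relation.Unary.Any.Properties using (any⁺; any⁻)
open import Data.List.Relation.Unary.Unique.Propositional using (Unique; _∷_)
open import Data.List.Relation.Unary.Unique.Propositional.Properties using (filter⁺; allFin⁺)
open import Data.Maybe using (just; nothing; _>>=_)
import Data.Maybe as Maybe
open import Data.Maybe.Properties using (just-injective)
open import Data.Integer using (ℤ; 0ℤ) renaming (_+_ to _+ℤ_)
open import Data.Integer.Properties using (+-identityˡ; +-identityʳ; -1*i≡-i; neg-injective)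
open import Data.Product using (_×_; _,_; proj₁; ∃-syntax)
import Data.Product as Product
open import Data.Sum using (_⊎_; inj₁; inj₂)
import Data.Sum as Sum
open import Function using (id; _∘_; _∋_; Injective)
open import Function.Bundles using (Equivalence)
open import Relation.Nullary using (¬_; Dec; yes; no; contradiction)
open import Relation.Nullary.Decidable using (isYes; isYes≗does; dec-true; dec-false; toWitness; fromWitness; T?; _×-dec_; _⊎-dec_)
open import Relation.Binary.Definitions using (DecidableEquality)
open import Relation.Binary.PropositionalEquality using (_≡_; _≢_; refl; sym; trans; cong; cong₂; subst; ≢-sym)

open Equivalence using (to; from)

isYes-true : ∀ {A : Set} (a? : Dec A) → A → isYes a? ≡ true
isYes-true a? a = trans (isYes≗does a?) (dec-true a? a)

isYes-false : ∀ {A : Set} (a? : Dec A) → ¬ A → isYes a? ≡ false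
isYes-false a? ¬a = trans (isYes≗does a?) (dec-false a? ¬a)

if-∧-true : ∀ {A : Set} {b c : Bool} {x y : A} → b ≡ true → c ≡ true → (if b ∧ c then x else y) ≡ x
if-∧-true refl refl = refl

if-∧-false : ∀ {A : Set} {b c : Bool} {x y : A} → b ≡ false → (if b ∧ c then x else y) ≡ y
if-∧-false refl = refl

m+n≡1+o⇒m≡1×n≡o : ∀ {m n o} → 1 ≤ m → o ≤ n → m + n ≡ suc o → m ≡ 1 × n ≡ o
m+n≡1+o⇒m≡1×n≡o {suc m} {n} {o} _ o≤n m+n≡1+o = cong suc m≡0 , n≡o
  where
    n≡o : n ≡ o
    n≡o = ≤-antisym (subst (n ≤_) (cong pred m+n≡1+o) (m≤n+m n m)) o≤n
    m≡0 : m ≡ 0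
    m≡0 = +-cancelʳ-≡ o m 0 (subst (λ k → m + k ≡ o) n≡o (cong pred m+n≡1+o))

foldr-+-single : ∀ {A : Set} {f : A → ℤ} {l : List A} {a : A} →
                 Unique l → a ∈ l → (∀ b → b ≢ a → f b ≡ 0ℤ) → foldr _+ℤ_ 0ℤ (map f l) ≡ f a
foldr-+-single {f = f} (a∉l ∷ _) (here refl) vanish =
  trans (cong (f _ +ℤ_) (sum-zero (All.map (λ a≢b → vanish _ (≢-sym a≢b)) a∉l))) (+-identityʳ _)
  where
    sum-zero : ∀ {l} → All (λ b → f b ≡ 0ℤ) l → foldr _+ℤ_ 0ℤ (map f l) ≡ 0ℤ
    sum-zero []          = refl
    sum-zero (fb≡0 ∷ zs) = cong₂ _+ℤ_ fb≡0 (sum-zero zs)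
foldr-+-single {f = f} {l = b ∷ l} (b∉l ∷ u) (there a∈l) vanish =
  trans (cong (_+ℤ foldr _+ℤ_ 0ℤ (map f l)) (vanish b (All.lookup b∉l a∈l)))
        (trans (+-identityˡ _) (foldr-+-single u a∈l vanish))

removeAt-injective : ∀ {A : Set} {k} (xs : Vec A (suc k)) → Injective _≡_ _≡_ (lookup xs) →
                     ∀ {i j} → removeAt xs i ≡ removeAt xs j → i ≡ j
removeAt-injective (x ∷ xs)     inj {zero}  {zero}  _ = refl
removeAt-injective (x ∷ y ∷ xs) inj {zero}  {suc j} e with inj {suc zero} {zero} (∷-injectiveˡ e)
... | ()
removeAt-injective (x ∷ y ∷ xs) inj {suc i} {zero}  e with inj {zero} {suc zero} (∷-injectiveˡ e)
... | ()
removeAt-injective (x ∷ y ∷ xs) inj {suc i} {suc j} e =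
  cong suc (removeAt-injective (y ∷ xs) (Fin-suc-injective ∘ inj) (∷-injectiveʳ e))

≢⇒2≤ : ∀ {m} {a b : Fin m} → a ≢ b → 2 ≤ m
≢⇒2≤ {suc zero}    {zero} {zero} a≢b = contradiction refl a≢b
≢⇒2≤ {suc (suc m)} _                 = s≤s (s≤s z≤n)

inject₁-inject₁≢suc-suc : ∀ {k} (p : Fin k) → inject₁ (inject₁ p) ≢ suc (suc p)
inject₁-inject₁≢suc-suc zero    ()
inject₁-inject₁≢suc-suc (suc p) = inject₁-inject₁≢suc-suc p ∘ Fin-suc-injective

data OneApart {k : ℕ} : Fin (suc k) → Fin (suc k) → Set where
  one-apart : (p : Fin k) → OneApart (inject₁ p) (suc p)

data TwoApart : {k : ℕ} → Fin (suc k) → Fin (suc k) → Set where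
  two-apart : ∀ {k} (p : Fin k) → TwoApart {suc k} (inject₁ (inject₁ p)) (suc (suc p))

oneApart : ∀ {k} (i j : Fin (suc k)) → toℕ j ≡ toℕ i + 1 → OneApart i j
oneApart zero    (suc zero) _ = one-apart zero
oneApart {suc k} (suc i) (suc j) e with oneApart i j (suc-injective e)
... | one-apart p = one-apart (suc p)

twoApart : ∀ {k} (i j : Fin (suc k)) → toℕ j ≡ toℕ i + 2 → TwoApart i j
twoApart zero (suc (suc zero)) _ = two-apart zero
twoApart {suc k} (suc i) (suc j) e with twoApart i j (suc-injective e)
... | two-apart p = two-apart (suc p)

UPair-dec : ∀ {A : Set} → DecidableEquality A → ∀ a b x y → Dec (UPair a b x y)
UPair-dec _≟_ a b x y = ((x ≟ a) ×-dec (y ≟ b)) ⊎-dec ((x ≟ b) ×-dec (y ≟ a))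

ES-dec : ∀ {n k} (xs : Vec (Fin n) (suc k)) x y → Dec (ES (H xs) x y)
ES-dec xs x y = apart? 1 ⊎-dec apart? 2
  where
    apart? : ∀ d → Dec (∃[ i ] ∃[ j ] (toℕ j ≡ toℕ i + d) × UPair (lookup xs i) (lookup xs j) x y)
    apart? d = any? λ i → any? λ j →
      (toℕ j ≟ℕ toℕ i + d) ×-dec UPair-dec _≟F_ (lookup xs i) (lookup xs j) x y

module _ {n : ℕ} (G : SimpleGraph n) where

  search-sound : ∀ f b {m} → search G f b ≡ just m → f m ≡ true
  search-sound f (suc b) found with search G f b in found′
  search-sound f (suc b) refl | just _  = search-sound f b found′
  search-sound f (suc b) found | nothing with f b in fb
  search-sound f (suc b) refl  | nothing | true = fb

  search-bound : ∀ f b {m} → search G f b ≡ just m → m < b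
  search-bound f (suc b) found with search G f b in found′
  search-bound f (suc b) refl | just _  = m≤n⇒m≤1+n (search-bound f b found′)
  search-bound f (suc b) found | nothing with f b
  search-bound f (suc b) refl  | nothing | true = ≤-refl

  search-least : ∀ f b {m} → f m ≡ true → m < b → ∃[ m′ ] search G f b ≡ just m′ × m′ ≤ m
  search-least f (suc b) fm (s≤s m≤b) with search G f b in found | m≤n⇒m<n∨m≡n m≤b
  ... | just m′ | inj₂ refl = m′ , refl , <⇒≤ (search-bound f b found)
  ... | just m′ | inj₁ m<b with search-least f b fm m<b
  ...   | _ , found′ , m″≤m with trans (sym found′) found
  ...     | refl = m′ , refl , m″≤m
  search-least f (suc b) fm (s≤s m≤b) | nothing | inj₁ m<b with search-least f b fm m<b
  ... | _ , found′ , _ with trans (sym found) found′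
  ...   | ()
  search-least f (suc b) fm (s≤s m≤b) | nothing | inj₂ refl rewrite fm = _ , refl , ≤-refl

  reach-zero⇒≡ : ∀ {x y} → T (reach G 0 x y) → x ≡ y
  reach-zero⇒≡ = toWitness

  reach-zero-refl : ∀ {x} → T (reach G 0 x x)
  reach-zero-refl = fromWitness refl

  reach-suc⁻ : ∀ m {x y} → T (reach G (suc m) x y) →
               T (reach G m x y) ⊎ ∃[ z ] T (reach G m x z) × T (adj G z y)
  reach-suc⁻ m r = Sum.map₂ (Product.map₂ (to T-∧) ∘ satisfied ∘ any⁻ _ (allFin n)) (to T-∨ r)

  reach-step : ∀ {m x y z} → T (reach G m x z) → T (adj G z y) → T (reach G (suc m) x y)
  reach-step {z = z} r a = from T-∨ (inj₂ (any⁺ _ (lose (∈-allFin z) (from T-∧ (r , a)))))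

  adj⇒≢ : ∀ {x y} → T (adj G x y) → x ≢ y
  adj⇒≢ {x} a refl = subst T (irrefl G x) a

  dist⇒reach : ∀ {x y d} → dist G x y ≡ just d → T (reach G d x y)
  dist⇒reach {x} {y} = from T-≡ ∘ search-sound (λ m → reach G m x y) (suc n)

  dist≡0⇒≡ : ∀ {x y} → dist G x y ≡ just 0 → x ≡ y
  dist≡0⇒≡ = reach-zero⇒≡ ∘ dist⇒reach

  dist-pos : ∀ {x y d} → x ≢ y → dist G x y ≡ just d → 1 ≤ d
  dist-pos {d = zero}  x≢y d≡0 = contradiction (dist≡0⇒≡ d≡0) x≢y
  dist-pos {d = suc d} _   _   = s≤s z≤n

  dist≡1⇒adj : ∀ {x y} → x ≢ y → dist G x y ≡ just 1 → T (adj G x y)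
  dist≡1⇒adj x≢y d≡1 with reach-suc⁻ 0 (dist⇒reach d≡1)
  ... | inj₁ r = contradiction (reach-zero⇒≡ r) x≢y
  ... | inj₂ (_ , r , a) with reach-zero⇒≡ r
  ...   | refl = a

  path₂⇒dist≤2 : ∀ {x y z} → T (adj G x z) → T (adj G z y) → ∃[ d ] dist G x y ≡ just d × d ≤ 2
  path₂⇒dist≤2 {x} {y} xz zy =
    search-least (λ m → reach G m x y) (suc n)
                 (to T-≡ (reach-step {1} {x} (reach-step {0} {x} reach-zero-refl xz) zy))
                 (s≤s (≢⇒2≤ (adj⇒≢ xz)))

  tupleLength-∷⁻ : ∀ {x y d ℓ} l → dist G x y ≡ just d → tupleLength G (x ∷ y ∷ l) ≡ just ℓ →
                  ∃[ ℓ′ ] tupleLength G (y ∷ l) ≡ just ℓ′ × d + ℓ′ ≡ ℓ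
  tupleLength-∷⁻ {x} {y} l = bind-just (dist G x y) (tupleLength G (y ∷ l))
    where
      bind-just : ∀ {d ℓ} m m′ → m ≡ just d → (m >>= λ d → Maybe.map (d +_) m′) ≡ just ℓ →
                  ∃[ ℓ′ ] m′ ≡ just ℓ′ × d + ℓ′ ≡ ℓ
      bind-just (just d) (just ℓ′) refl len = ℓ′ , refl , just-injective len
      bind-just (just d) nothing   refl ()

  tupleLength-∷⁺ : ∀ {x y d ℓ} l → dist G x y ≡ just d → tupleLength G (y ∷ l) ≡ just ℓ →
                   tupleLength G (x ∷ y ∷ l) ≡ just (d + ℓ)
  tupleLength-∷⁺ l = bind-just
    where
      bind-just : ∀ {m m′ d ℓ} → m ≡ just d → m′ ≡ just ℓ →
                  (m >>= λ d → Maybe.map (d +_) m′) ≡ just (d + ℓ)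
      bind-just refl refl = refl

  UnitSteps : ∀ {k} → Vec (Fin n) (suc k) → Set
  UnitSteps {k} xs = (p : Fin k) → dist G (lookup xs (inject₁ p)) (lookup xs (suc p)) ≡ just 1

  trail-length-≥ : ∀ {k ℓ} (xs : Vec (Fin n) (suc k)) → IsTrail G xs →
                   tupleLength G (toList xs) ≡ just ℓ → k ≤ ℓ
  trail-length-≥ (x ∷ [])     _ _ = z≤n
  trail-length-≥ (x ∷ y ∷ xs) t len with t zero
  ... | x≢y , _ , d≡ with tupleLength-∷⁻ (toList xs) d≡ len
  ...   | _ , len′ , refl = +-mono-≤ (dist-pos x≢y d≡) (trail-length-≥ (y ∷ xs) (λ p → t (suc p)) len′)

  trail-length≡⇒UnitSteps : ∀ {k} (xs : Vec (Fin n) (suc k)) → IsTrail G xs →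
                            tupleLength G (toList xs) ≡ just k → UnitSteps xs
  trail-length≡⇒UnitSteps (x ∷ [])     _ _ = λ ()
  trail-length≡⇒UnitSteps (x ∷ y ∷ xs) t len with t zero
  ... | x≢y , _ , d≡ with tupleLength-∷⁻ (toList xs) d≡ len
  ...   | _ , len′ , d+ℓ′≡k
    with m+n≡1+o⇒m≡1×n≡o (dist-pos x≢y d≡) (trail-length-≥ (y ∷ xs) (λ p → t (suc p)) len′) d+ℓ′≡k
  ...     | refl , refl = λ where
    zero    → d≡
    (suc p) → trail-length≡⇒UnitSteps (y ∷ xs) (λ p → t (suc p)) len′ p

  UnitSteps⇒tupleLength : ∀ {k} (xs : Vec (Fin n) (suc k)) → UnitSteps xs → tupleLength G (toList xs) ≡ just k
  UnitSteps⇒tupleLength (x ∷ [])     _ = refl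
  UnitSteps⇒tupleLength (x ∷ y ∷ xs) u =
    tupleLength-∷⁺ (toList xs) (u zero) (UnitSteps⇒tupleLength (y ∷ xs) (λ p → u (suc p)))

  shortcut-length : ∀ {k} (xs : Vec (Fin n) (suc (suc k))) → UnitSteps xs → (p : Fin k) →
                    dist G (lookup xs (inject₁ (inject₁ p))) (lookup xs (suc (suc p))) ≡ just 2 →
                    tupleLength G (toList (removeAt xs (suc (inject₁ p)))) ≡ just (suc k)
  shortcut-length (x ∷ y ∷ z ∷ xs) u zero d≡2 =
    tupleLength-∷⁺ (toList xs) d≡2 (UnitSteps⇒tupleLength (z ∷ xs) (λ p → u (suc (suc p))))
  shortcut-length (x ∷ y ∷ z ∷ xs) u (suc p) d≡2 =
    tupleLength-∷⁺ (toList (removeAt (z ∷ xs) (inject₁ p))) (u zero)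
                   (shortcut-length (y ∷ z ∷ xs) (λ p → u (suc p)) p d≡2)

  sign≢0 : ∀ i → sign G i ≢ 0ℤ
  sign≢0 zero    ()
  sign≢0 (suc i) e = sign≢0 i (neg-injective (trans (sym (-1*i≡-i (sign G i))) e))

  -- The summands of ∂ are where-bound in Defs and cannot be named: the ascription lets
  -- unification read them off the unfolded sum, after which the length test on the face
  -- at i becomes visible to with.
  ∂-removeAt : ∀ {k ℓ} (xs : Vec (Fin n) (suc k)) → Injective _≡_ _≡_ (lookup xs) →
               (i : Fin (suc k)) → 0 < toℕ i → toℕ i < k →
               tupleLength G (toList (removeAt xs i)) ≡ just ℓ → ∂ G k ℓ xs (removeAt xs i) ≡ sign G (toℕ i)
  ∂-removeAt {k} {ℓ} xs inj i 0<i i<k len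
    with ∂ G k ℓ xs (removeAt xs i) ≡ _ ∋
         foldr-+-single unique interior (λ j j≢i →
           if-∧-false (isYes-false (≡-dec _≟F_ (removeAt xs j) (removeAt xs i))
                                   (j≢i ∘ removeAt-injective xs inj)))
    where
      interior? : Fin (suc k) → Bool
      interior? j = isYes (0 <? toℕ j) ∧ isYes (toℕ j <? k)
      unique : Unique (filterᵇ interior? (allFin (suc k)))
      unique = filter⁺ (T? ∘ interior?) (allFin⁺ (suc k))
      interior : i ∈ filterᵇ interior? (allFin (suc k))
      interior = ∈-filter⁺ (T? ∘ interior?) (∈-allFin i)
                   (from T-∧ (fromWitness {a? = 0 <? toℕ i} 0<i , fromWitness {a? = toℕ i <? k} i<k))
  ... | ∂≡summand with tupleLength G (toList (removeAt xs i)) | len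
  ...   | just _ | refl =
    trans ∂≡summand (if-∧-true (isYes-true (≡-dec _≟F_ (removeAt xs i) (removeAt xs i)) refl)
                               (isYes-true (ℓ ≟ℕ ℓ) refl))

  neighbours-adjacent : ∀ {k} (xs : Vec (Fin n) (suc k)) → IsTrail G xs → UnitSteps xs →
                        ∀ {i j} → OneApart i j → T (adj G (lookup xs i) (lookup xs j))
  neighbours-adjacent xs t u (one-apart p) = dist≡1⇒adj (proj₁ (t p)) (u p)

  second-neighbours-adjacent : ∀ {k} (xs : Vec (Fin n) (suc k)) → IsTrail G xs → IsEulerian G xs →
                               UnitSteps xs → (∀ y → ∂ G k k xs y ≡ 0ℤ) →
                               ∀ {i j} → TwoApart i j → T (adj G (lookup xs i) (lookup xs j))
  second-neighbours-adjacent xs t eu u ∂≡0 (two-apart p) =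
    by-distance (path₂⇒dist≤2 (neighbours-adjacent xs t u (one-apart (inject₁ p)))
                              (neighbours-adjacent xs t u (one-apart (suc p))))
    where
      x y : Fin n
      x = lookup xs (inject₁ (inject₁ p))
      y = lookup xs (suc (suc p))
      x≢y : x ≢ y
      x≢y = inject₁-inject₁≢suc-suc p ∘ eu _ _
      by-distance : ∃[ d ] dist G x y ≡ just d × d ≤ 2 → T (adj G x y)
      by-distance (0 , d≡0 , _) = contradiction (dist≡0⇒≡ d≡0) x≢y
      by-distance (1 , d≡1 , _) = dist≡1⇒adj x≢y d≡1
      by-distance (2 , d≡2 , _) =
        contradiction (trans (sym (∂-removeAt xs (eu _ _) (suc (inject₁ p)) (s≤s z≤n) (s≤s (inject₁ℕ< p))
                                              (shortcut-length xs u p d≡2)))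
                             (∂≡0 _))
                      (sign≢0 (toℕ (suc (inject₁ p))))
      by-distance (suc (suc (suc _)) , _ , s≤s (s≤s ()))

  UPair-edge : ∀ {k} (xs : Vec (Fin n) (suc k)) {i j x y} →
               T (adj G (lookup xs i) (lookup xs j)) → UPair (lookup xs i) (lookup xs j) x y →
               inducedEdge G (L xs) x y
  UPair-edge xs {i} {j} a (inj₁ (refl , refl)) = ∈-lookup i xs , ∈-lookup j xs , to T-≡ a
  UPair-edge xs {i} {j} a (inj₂ (refl , refl)) =
    ∈-lookup j xs , ∈-lookup i xs , trans (adj-sym G _ _) (to T-≡ a)

lemma3p4 : {n : ℕ} (G : SimpleGraph n) (k : ℕ) (xs : Vec (Fin n) (suc k)) →
    InET G k k xs →
    (∀ (y : Vec (Fin n) k) → ∂ G k k xs y ≡ 0ℤ) →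
    InΓ (H xs) (L xs) (inducedEdge G (L xs))
lemma3p4 G k xs (trail , eulerian , length) ∂≡0 = (λ _ → id , id) , spanning , classified
  where
    unit : UnitSteps G xs
    unit = trail-length≡⇒UnitSteps G xs trail length
    spanning : ∀ x y → ES (H xs) x y → inducedEdge G (L xs) x y
    spanning x y (inj₁ (i , j , j≡i+1 , xy)) =
      UPair-edge G xs (neighbours-adjacent G xs trail unit (oneApart i j j≡i+1)) xy
    spanning x y (inj₂ (i , j , j≡i+2 , xy)) =
      UPair-edge G xs (second-neighbours-adjacent G xs trail eulerian unit ∂≡0 (twoApart i j j≡i+2)) xy
    classified : ∀ x y → inducedEdge G (L xs) x y → ES (H xs) x y ⊎ EB (H xs) x y
    classified x y (x∈ , y∈ , a) with ES-dec xs x y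
    ... | yes s  = inj₁ s
    ... | no ¬s = inj₂ (x∈ , y∈ , adj⇒≢ G (from T-≡ a) , ¬s)
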